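{- Any derivation $\mathcal P$ in $\mathrm{LJ}$ extended with 2-systems can be transformed into a derivation $\mathcal P'$ (in the same calculus) of the same end-sequent in which no two 2-system instances are entangled.
   Context: $\mathrm{LJ}$ is the propositional intuitionistic sequent calculus. A 2-system is a set of sequent rules $\{(r_1),\dots,(r_k),(r_B)\}$ used only as follows: the bottom rule $(r_B)$ infers $\Gamma\Rightarrow\Pi$ from $k$ premisses all equal to $\Gamma\Rightarrow\Pi$, where the derivation of the $i$-th premiss may contain (possibly several) applications of the top rule $(r_i)$, which infers $\Sigma_0,\Gamma'\Rightarrow\Pi'$ from $\Sigma_1,\Gamma'\Rightarrow\Pi',\dots,\Sigma_n,\Gamma'\Rightarrow\Pi'$ (same $\Sigma_0,\dots,\Sigma_n$ in all applications of the instance). A 2-system instance is one application of a bottom rule together with the top rule applications it discharges. Two 2-system instances $S_1,S_2$ are entangled if some top rules of $S_1$ occur above some top rules of $S_2$ and some (top rules of $S_1$) occur below some top rules of $S_2$. -}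

module Defs where

open import Data.Nat using (ℕ; _≤_)
import Data.Nat as ℕ
open import Data.Fin using (Fin; toℕ)
open import Data.List using (List; []; _∷_; _++_; map; concatMap; allFin)
open import Data.List.Membership.Propositional using (_∈_)
open import Data.List.Relation.Unary.Any using (here; there)
open import Data.Maybe using (Maybe; just; nothing)
open import Data.Product using (Σ; _×_; _,_)
open import Relation.Binary.PropositionalEquality using (_≡_; _≢_)

data Fm : Set where
  at  : ℕ → Fm
  ⊥'  : Fm
  _∧'_ _∨'_ _⊃_ : Fm → Fm → Fm

-- Formula schemata (used in the Σ's of top rules): formulas built
-- from metavariables `mv n` (ranging over arbitrary formulas).
data Sch : Set where
  mv  : ℕ → Sch
  at  : ℕ → Sch
  ⊥'  : Sch
  _∧'_ _∨'_ _⊃_ : Sch → Sch → Sch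

inst : (ℕ → Fm) → Sch → Fm
inst σ (mv n)   = σ n
inst σ (at p)   = at p
inst σ ⊥'       = ⊥'
inst σ (A ∧' B) = inst σ A ∧' inst σ B
inst σ (A ∨' B) = inst σ A ∨' inst σ B
inst σ (A ⊃ B)  = inst σ A ⊃ inst σ B

instL : (ℕ → Fm) → List Sch → List Fm
instL σ = map (inst σ)

record Seq : Set where
  constructor _⇒_
  field
    ant : List Fm
    suc : Maybe Fm

-- The rules of LJ (Gentzen style: lists, explicit structural rules, cut)
-- LJRule ps c : from premisses ps infer conclusion c

data LJRule : List Seq → Seq → Set where
  ax   : ∀ {A} → LJRule [] ((A ∷ []) ⇒ just A)
  ⊥L   : LJRule [] ((⊥' ∷ []) ⇒ nothing)
  WL   : ∀ {A Γ Π} → LJRule ((Γ ⇒ Π) ∷ []) ((A ∷ Γ) ⇒ Π)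
  WR   : ∀ {A Γ} → LJRule ((Γ ⇒ nothing) ∷ []) (Γ ⇒ just A)
  CL   : ∀ {A Γ Π} → LJRule (((A ∷ A ∷ Γ) ⇒ Π) ∷ []) ((A ∷ Γ) ⇒ Π)
  XL   : ∀ {A B Γ Δ Π} →
         LJRule (((Γ ++ A ∷ B ∷ Δ) ⇒ Π) ∷ []) ((Γ ++ B ∷ A ∷ Δ) ⇒ Π)
  cut  : ∀ {A Γ Δ Π} →
         LJRule ((Γ ⇒ just A) ∷ ((A ∷ Δ) ⇒ Π) ∷ []) ((Γ ++ Δ) ⇒ Π)
  ∧L₁  : ∀ {A B Γ Π} → LJRule (((A ∷ Γ) ⇒ Π) ∷ []) (((A ∧' B) ∷ Γ) ⇒ Π)
  ∧L₂  : ∀ {A B Γ Π} → LJRule (((B ∷ Γ) ⇒ Π) ∷ []) (((A ∧' B) ∷ Γ) ⇒ Π)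
  ∧R   : ∀ {A B Γ} →
         LJRule ((Γ ⇒ just A) ∷ (Γ ⇒ just B) ∷ []) (Γ ⇒ just (A ∧' B))
  ∨L   : ∀ {A B Γ Π} →
         LJRule (((A ∷ Γ) ⇒ Π) ∷ ((B ∷ Γ) ⇒ Π) ∷ []) (((A ∨' B) ∷ Γ) ⇒ Π)
  ∨R₁  : ∀ {A B Γ} → LJRule ((Γ ⇒ just A) ∷ []) (Γ ⇒ just (A ∨' B))
  ∨R₂  : ∀ {A B Γ} → LJRule ((Γ ⇒ just B) ∷ []) (Γ ⇒ just (A ∨' B))
  ⊃L   : ∀ {A B Γ Δ Π} →
         LJRule ((Γ ⇒ just A) ∷ ((B ∷ Δ) ⇒ Π) ∷ []) (((A ⊃ B) ∷ Γ ++ Δ) ⇒ Π)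
  ⊃R   : ∀ {A B Γ} → LJRule (((A ∷ Γ) ⇒ just B) ∷ []) (Γ ⇒ just (A ⊃ B))

-- A top rule: from Σ₁,Γ'⇒Π' … Σₙ,Γ'⇒Π' infer Σ₀,Γ'⇒Π'
record TopRule : Set where
  field
    Σ₀   : List Sch
    Σs   : List (List Sch)

-- A 2-system {(r₁),…,(r_k),(r_B)} with k ≥ 1 top rules
-- (the bottom rule r_B is determined by k).
record TwoSystem : Set where
  field
    k     : ℕ
    k≥1   : 1 ≤ k
    tops  : Fin k → TopRule
open TwoSystem public

module Calculus {I : Set} (S : I → TwoSystem) where

  -- an open (not yet discharged) 2-system instance, seen from inside the
  -- derivation of its i-th premiss: which system, the instantiation of
  -- the metavariables (shared by all applications of its top rules),
  -- and the premiss index i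
  record Open : Set where
    constructor open⟨_,_,_⟩
    field
      sys : I
      σ   : ℕ → Fm
      idx : Fin (k (S sys))

  topRule : Open → TopRule
  topRule o = tops (S (Open.sys o)) (Open.idx o)

  topPrems : Open → List Fm → Maybe Fm → List Seq
  topPrems o Γ Π = map (λ Σj → (instL (Open.σ o) Σj ++ Γ) ⇒ Π) (TopRule.Σs (topRule o))

  topConcl : Open → List Fm → Maybe Fm → Seq
  topConcl o Γ Π = (instL (Open.σ o) (TopRule.Σ₀ (topRule o)) ++ Γ) ⇒ Π

  -- A top rule application refers (by a membership proof, i.e. a de Bruijn
  -- index) to the bottom rule application that discharges it.
  mutual
    data Der (Δ : List Open) : Seq → Set where
      lj  : ∀ {ps c} → LJRule ps c → Ders Δ ps → Der Δ c
      top : ∀ {o : Open} → o ∈ Δ → (Γ : List Fm) (Π : Maybe Fm) →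
            Ders Δ (topPrems o Γ Π) → Der Δ (topConcl o Γ Π)
      bot : ∀ {Γ Π} (s : I) (σ : ℕ → Fm) →
            ((i : Fin (k (S s))) → Der (open⟨ s , σ , i ⟩ ∷ Δ) (Γ ⇒ Π)) →
            Der Δ (Γ ⇒ Π)

    data Ders (Δ : List Open) : List Seq → Set where
      []  : Ders Δ []
      _∷_ : ∀ {s ss} → Der Δ s → Ders Δ ss → Ders Δ (s ∷ ss)

  -- Addresses of nodes: paths from the root (list of premiss indices).

  Address : Set
  Address = List ℕ

  Above : Address → Address → Set
  Above p q = Σ ℕ λ x → Σ (List ℕ) λ xs → p ≡ q ++ (x ∷ xs)

  -- the bottom rule at address a becomes the innermost open instance
  ext : ∀ {Δ} {o' : Open} → (∀ {o : Open} → o ∈ Δ → Address) → Address →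
        ∀ {o : Open} → o ∈ (o' ∷ Δ) → Address
  ext env a (here _)  = a
  ext env a (there m) = env m

  -- All top rule applications, as pairs
  -- (address of the top rule application, address of its bottom rule application)
  mutual
    topsD : ∀ {Δ s} → Der Δ s → (∀ {o : Open} → o ∈ Δ → Address) → Address →
            List (Address × Address)
    topsD (lj r ds)     env a = topsDs ds env a 0
    topsD (top m Γ Π ds) env a = (a , env m) ∷ topsDs ds env a 0
    topsD (bot s σ f)   env a = topsF f env a

    topsDs : ∀ {Δ ss} → Ders Δ ss → (∀ {o : Open} → o ∈ Δ → Address) → Address →
             ℕ → List (Address × Address)
    topsDs []       env a j = []
    topsDs (d ∷ ds) env a j = topsD d env (a ++ j ∷ []) ++ topsDs ds env a (ℕ.suc j)

    topsF : ∀ {Δ Γ Π} {s : I} {σ : ℕ → Fm} →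
            ((i : Fin (k (S s))) → Der (open⟨ s , σ , i ⟩ ∷ Δ) (Γ ⇒ Π)) →
            (∀ {o : Open} → o ∈ Δ → Address) → Address → List (Address × Address)
    topsF {s = s} f env a =
      concatMap (λ i → topsD (f i) (ext env a) (a ++ toℕ i ∷ [])) (allFin (k (S s)))

  topsOf : ∀ {s} → Der [] s → List (Address × Address)
  topsOf d = topsD d (λ ()) []

  Entangled : ∀ {s} → Der [] s → Set
  Entangled d =
    Σ Address λ b₁ → Σ Address λ b₂ → Σ Address λ t₁ → Σ Address λ t₂ →
    Σ Address λ t₁' → Σ Address λ t₂' →
      b₁ ≢ b₂ ×
      (t₁ , b₁) ∈ topsOf d × (t₂ , b₂) ∈ topsOf d × Above t₁ t₂ ×
      (t₁' , b₁) ∈ topsOf d × (t₂' , b₂) ∈ topsOf d × Above t₂' t₁'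

module Submission where

-- Every application of a top rule  Σ₁,Γ⇒Π … Σₙ,Γ⇒Π / Σ₀,Γ⇒Π  (with the
-- metavariables instantiated by σ) is replaced, with D = ⋁ⱼ ⋀Σⱼ, by
--
--      Σⱼ ⇒ D  (pure LJ, for every j)
--     ------------------------------ top         D,Γ ⇒ Π  (∨L, ∧L from the
--               Σ₀ ⇒ D                                     old premisses)
--     ------------------------------------------------------------- cut
--                               Σ₀,Γ ⇒ Π
--
-- using the same instance and the same top rule, so the 2-system instance
-- structure is untouched, while the premisses of the new top rule
-- application contain no top rules at all.  Doing this everywhere yields a
-- derivation of top-rule nesting depth at most 1 ("flat"): no top rule
-- application lies above another one, so no two instances can be
-- entangled.

open import Defs
open import Data.Product using (Σ)
open import Data.List using ([])
open import Relation.Nullary using (¬_)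

open import Data.Nat using (ℕ; zero; suc; _≤_)
open import Data.Nat.Properties using (≤-refl; ≤-trans; n≤1+n; <-irrefl)
open import Data.Fin using (Fin; toℕ)
open import Data.Fin.Properties using (toℕ-injective)
open import Data.List using (List; _∷_; _++_; map; allFin)
open import Data.List.Properties using (++-assoc; ++-identityʳ; ++-identityʳ-unique; ++-cancelˡ; ∷-injectiveˡ)
open import Data.List.Membership.Propositional using (_∈_; _∉_)
open import Data.List.Membership.Propositional.Properties using (∈-++⁻; ∈-map⁺; ∈-concatMap⁻)
open import Data.List.Relation.Unary.Any using (here; there; satisfied)
open import Data.Maybe using (Maybe; just; nothing)
open import Data.Product using (_×_; _,_; proj₁; proj₂)
open import Data.Sum using (inj₁; inj₂)
open import Data.Unit using (⊤; tt)
open import Data.Empty using (⊥)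
open import Relation.Binary.PropositionalEquality using (_≡_; refl; sym; trans; cong)

mutual
  data LJH (hs : List Seq) : Seq → Set where
    hyp  : ∀ {s} → s ∈ hs → LJH hs s
    rule : ∀ {ps c} → LJRule ps c → LJHs hs ps → LJH hs c

  data LJHs (hs : List Seq) : List Seq → Set where
    []  : LJHs hs []
    _∷_ : ∀ {s ss} → LJH hs s → LJHs hs ss → LJHs hs (s ∷ ss)

⊤' : Fm
⊤' = ⊥' ⊃ ⊥'

conj : List Fm → Fm
conj []       = ⊤'
conj (A ∷ As) = A ∧' conj As

disj : List Fm → Fm
disj []       = ⊥'
disj (C ∷ Cs) = C ∨' disj Cs

module _ {hs : List Seq} where

  r1 : ∀ {p c} → LJRule (p ∷ []) c → LJH hs p → LJH hs c
  r1 r h = rule r (h ∷ [])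

  substA : ∀ {Γ₁ Γ₂ Π} → Γ₁ ≡ Γ₂ → LJH hs (Γ₁ ⇒ Π) → LJH hs (Γ₂ ⇒ Π)
  substA refl h = h

  private
    shift : ∀ (Γ₀ : List Fm) B (L : List Fm) → (Γ₀ ++ B ∷ []) ++ L ≡ Γ₀ ++ B ∷ L
    shift Γ₀ B L = ++-assoc Γ₀ (B ∷ []) L

  bringForward : ∀ Γ₀ Γ {A Δ Π} →
                 LJH hs ((Γ₀ ++ Γ ++ A ∷ Δ) ⇒ Π) → LJH hs ((Γ₀ ++ A ∷ Γ ++ Δ) ⇒ Π)
  bringForward Γ₀ []      h = h
  bringForward Γ₀ (B ∷ Γ) {A} {Δ} h =
    r1 (XL {Γ = Γ₀}) (substA (shift Γ₀ B (A ∷ Γ ++ Δ))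
      (bringForward (Γ₀ ++ B ∷ []) Γ (substA (sym (shift Γ₀ B (Γ ++ A ∷ Δ))) h)))

  sendBack : ∀ Γ₀ Γ {A Δ Π} →
             LJH hs ((Γ₀ ++ A ∷ Γ ++ Δ) ⇒ Π) → LJH hs ((Γ₀ ++ Γ ++ A ∷ Δ) ⇒ Π)
  sendBack Γ₀ []      h = h
  sendBack Γ₀ (B ∷ Γ) {A} {Δ} h =
    substA (shift Γ₀ B (Γ ++ A ∷ Δ))
      (sendBack (Γ₀ ++ B ∷ []) Γ (substA (sym (shift Γ₀ B (A ∷ Γ ++ Δ))) (r1 (XL {Γ = Γ₀}) h)))

  weakenL : ∀ (Γ₀ : List Fm) {Γ Π} → LJH hs (Γ ⇒ Π) → LJH hs ((Γ₀ ++ Γ) ⇒ Π)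
  weakenL []       h = h
  weakenL (A ∷ Γ₀) h = r1 WL (weakenL Γ₀ h)

  axiomIn : ∀ A Γ → LJH hs ((A ∷ Γ) ⇒ just A)
  axiomIn A Γ = substA (cong (A ∷_) (++-identityʳ Γ))
                  (bringForward [] Γ {Δ = []} (weakenL Γ (rule ax [])))

  botL : ∀ Γ Π → LJH hs ((⊥' ∷ Γ) ⇒ Π)
  botL Γ nothing  = substA (cong (⊥' ∷_) (++-identityʳ Γ))
                      (bringForward [] Γ {Δ = []} (weakenL Γ (rule ⊥L [])))
  botL Γ (just A) = r1 WR (botL Γ nothing)

  conjL : ∀ As {Γ Π} → LJH hs ((As ++ Γ) ⇒ Π) → LJH hs ((conj As ∷ Γ) ⇒ Π)
  conjL []       h = r1 WL h
  conjL (A ∷ As) {Γ} h =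
    r1 CL (r1 ∧L₂ (r1 (XL {Γ = []}) (r1 ∧L₁ (r1 (XL {Γ = []})
      (conjL As {A ∷ Γ} (sendBack [] As h))))))

  conjR : ∀ As → LJH hs (As ⇒ just (conj As))
  conjR []       = r1 ⊃R (rule ax [])
  conjR (A ∷ As) = rule ∧R (axiomIn A As ∷ r1 WL (conjR As) ∷ [])

  disjR : ∀ {C Cs Γ} → C ∈ Cs → LJH hs (Γ ⇒ just C) → LJH hs (Γ ⇒ just (disj Cs))
  disjR (here refl) h = r1 ∨R₁ h
  disjR (there m)   h = r1 ∨R₂ (disjR m h)

  casesL : ∀ {A : Set} (f : A → List Fm) (xs : List A) {Γ Π} →
           (∀ {x} → x ∈ xs → ((f x ++ Γ) ⇒ Π) ∈ hs) →
           LJH hs ((disj (map (λ x → conj (f x)) xs) ∷ Γ) ⇒ Π)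
  casesL f []       {Γ} {Π} prem = botL Γ Π
  casesL f (x ∷ xs) prem =
    rule ∨L (conjL (f x) (hyp (prem (here refl))) ∷ casesL f xs (λ m → prem (there m)) ∷ [])

  casesR : ∀ {A : Set} (f : A → List Fm) {x : A} {xs : List A} →
           x ∈ xs → LJH hs (f x ⇒ just (disj (map (λ y → conj (f y)) xs)))
  casesR f {x} m = disjR (∈-map⁺ (λ y → conj (f y)) m) (conjR (f x))

  ljhMap : ∀ {A : Set} (f : A → Seq) (xs : List A) →
           (∀ {x} → x ∈ xs → LJH hs (f x)) → LJHs hs (map f xs)
  ljhMap f []       d = []
  ljhMap f (x ∷ xs) d = d (here refl) ∷ ljhMap f xs (λ m → d (there m))

module Flattening {I : Set} (S : I → TwoSystem) where
  open Calculus S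

  -- Depth 0 means top-rule free; depth 1
  -- ("flat") means every top rule application has top-rule free premisses.
  mutual
    Nest : ∀ {Δ s} → ℕ → Der Δ s → Set
    Nest n       (lj r ds)      = Nests n ds
    Nest zero    (top m Γ Π ds) = ⊥
    Nest (suc n) (top m Γ Π ds) = Nests n ds
    Nest n       (bot s σ f)    = ∀ i → Nest n (f i)

    Nests : ∀ {Δ ss} → ℕ → Ders Δ ss → Set
    Nests n []       = ⊤
    Nests n (d ∷ ds) = Nest n d × Nests n ds

  -- Grafting derivations onto the hypotheses of a pure LJ derivation; this
  -- adds no top rules, so it preserves every bound on the nesting depth.
  lookupDer : ∀ {Δ hs s} → Ders Δ hs → s ∈ hs → Der Δ s
  lookupDer (d ∷ ds) (here refl) = d
  lookupDer (d ∷ ds) (there m)   = lookupDer ds m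

  lookupNest : ∀ {Δ hs s} n (ds : Ders Δ hs) (m : s ∈ hs) → Nests n ds → Nest n (lookupDer ds m)
  lookupNest n (d ∷ ds) (here refl) (nd , nds) = nd
  lookupNest n (d ∷ ds) (there m)   (nd , nds) = lookupNest n ds m nds

  mutual
    graft : ∀ {Δ hs s} → LJH hs s → Ders Δ hs → Der Δ s
    graft (hyp m)     ds = lookupDer ds m
    graft (rule r hs) ds = lj r (grafts hs ds)

    grafts : ∀ {Δ hs ss} → LJHs hs ss → Ders Δ hs → Ders Δ ss
    grafts []       ds = []
    grafts (h ∷ hs) ds = graft h ds ∷ grafts hs ds

  mutual
    graftNest : ∀ {Δ hs s} n (h : LJH hs s) (ds : Ders Δ hs) → Nests n ds → Nest n (graft h ds)
    graftNest n (hyp m)     ds nds = lookupNest n ds m nds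
    graftNest n (rule r hs) ds nds = graftsNest n hs ds nds

    graftsNest : ∀ {Δ hs ss} n (h : LJHs hs ss) (ds : Ders Δ hs) → Nests n ds → Nests n (grafts h ds)
    graftsNest n []       ds nds = tt
    graftsNest n (h ∷ hs) ds nds = graftNest n h ds nds , graftsNest n hs ds nds

  Flat : List Open → Seq → Set
  Flat Δ s = Σ (Der Δ s) (Nest 1)

  flattenTop : ∀ {Δ} {o : Open} (m : o ∈ Δ) (Γ : List Fm) (Π : Maybe Fm)
               (ds : Ders Δ (topPrems o Γ Π)) → Nests 1 ds → Flat Δ (topConcl o Γ Π)
  flattenTop {Δ} {o} m Γ Π ds nds = fixAnt (cut' , (nprems , graftNest 1 left ds nds , tt))
    where
    σ  = Open.σ o
    Σs = TopRule.Σs (topRule o)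
    Σ₀ = TopRule.Σ₀ (topRule o)
    D  = disj (map (λ Σj → conj (instL σ Σj)) Σs)

    right : LJHs [] (topPrems o [] (just D))
    right = ljhMap (λ Σj → (instL σ Σj ++ []) ⇒ just D) Σs
              (λ {Σj} mj → substA (sym (++-identityʳ (instL σ Σj))) (casesR (instL σ) mj))

    prems : Ders Δ (topPrems o [] (just D))
    prems = grafts right []

    nprems : Nests 0 prems
    nprems = graftsNest 0 right [] tt

    left : LJH (topPrems o Γ Π) ((D ∷ Γ) ⇒ Π)
    left = casesL (instL σ) Σs (∈-map⁺ (λ Σj → (instL σ Σj ++ Γ) ⇒ Π))

    cut' : Der Δ (((instL σ Σ₀ ++ []) ++ Γ) ⇒ Π)
    cut' = lj cut (top m [] (just D) prems ∷ graft left ds ∷ [])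

    fixAnt : Flat Δ (((instL σ Σ₀ ++ []) ++ Γ) ⇒ Π) → Flat Δ (topConcl o Γ Π)
    fixAnt d rewrite ++-identityʳ (instL σ Σ₀) = d

  mutual
    flatten : ∀ {Δ s} → Der Δ s → Flat Δ s
    flatten (lj r ds) with flattens ds
    ... | ds' , nds' = lj r ds' , nds'
    flatten (top m Γ Π ds) with flattens ds
    ... | ds' , nds' = flattenTop m Γ Π ds' nds'
    flatten (bot s σ f) = bot s σ (λ i → proj₁ (flatten (f i))) , (λ i → proj₂ (flatten (f i)))

    flattens : ∀ {Δ ss} → Ders Δ ss → Σ (Ders Δ ss) (Nests 1)
    flattens []       = [] , tt
    flattens (d ∷ ds) with flatten d | flattens ds
    ... | d' , nd' | ds' , nds' = (d' ∷ ds') , (nd' , nds')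

  Env : List Open → Set
  Env Δ = ∀ {o : Open} → o ∈ Δ → Address

  branchOf : ∀ {Δ Γ Π} {s : I} {σ : ℕ → Fm}
             (f : (i : Fin (k (S s))) → Der (open⟨ s , σ , i ⟩ ∷ Δ) (Γ ⇒ Π))
             (env : Env Δ) (a : Address) → ∀ {t} → t ∈ topsF f env a →
             Σ (Fin (k (S s))) λ i → t ∈ topsD (f i) (ext env a) (a ++ toℕ i ∷ [])
  branchOf {s = s} f env a m =
    satisfied (∈-concatMap⁻ (λ i → topsD (f i) (ext env a) (a ++ toℕ i ∷ [])) {xs = allFin (k (S s))} m)

  mutual
    topFreeNoTops : ∀ {Δ s} (d : Der Δ s) → Nest 0 d → (env : Env Δ) (a : Address) →
                    ∀ {t} → t ∉ topsD d env a
    topFreeNoTops (lj r ds)   n env a m = topFreeNoTopss ds n env a 0 m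
    topFreeNoTops (bot s σ f) n env a m with branchOf f env a m
    ... | i , m' = topFreeNoTops (f i) (n i) (ext env a) (a ++ toℕ i ∷ []) m'

    topFreeNoTopss : ∀ {Δ ss} (ds : Ders Δ ss) → Nests 0 ds → (env : Env Δ) (a : Address) (j : ℕ) →
                     ∀ {t} → t ∉ topsDs ds env a j
    topFreeNoTopss (d ∷ ds) (n , ns) env a j m with ∈-++⁻ (topsD d env (a ++ j ∷ [])) m
    ... | inj₁ m' = topFreeNoTops d n env (a ++ j ∷ []) m'
    ... | inj₂ m' = topFreeNoTopss ds ns env a (suc j) m'

  InSubtree : Address → ℕ → Address → Set
  InSubtree a j p = Σ Address λ xs → p ≡ a ++ j ∷ xs

  mutual
    topsAbove : ∀ {Δ s} (d : Der Δ s) (env : Env Δ) (a : Address) → ∀ {p b} →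
                (p , b) ∈ topsD d env a → Σ Address λ xs → p ≡ a ++ xs
    topsAbove (lj r ds) env a m with topsInSubtrees ds env a 0 m
    ... | j , _ , xs , e = (j ∷ xs) , e
    topsAbove (top _ Γ Π ds) env a (here refl) = [] , sym (++-identityʳ a)
    topsAbove (top _ Γ Π ds) env a (there m) with topsInSubtrees ds env a 0 m
    ... | j , _ , xs , e = (j ∷ xs) , e
    topsAbove (bot s σ f) env a m with topsInBranches f env a m
    ... | i , xs , e = (toℕ i ∷ xs) , e

    topsInSubtrees : ∀ {Δ ss} (ds : Ders Δ ss) (env : Env Δ) (a : Address) (j : ℕ) → ∀ {p b} →
                     (p , b) ∈ topsDs ds env a j → Σ ℕ λ j' → j ≤ j' × InSubtree a j' p
    topsInSubtrees (d ∷ ds) env a j m with ∈-++⁻ (topsD d env (a ++ j ∷ [])) m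
    ... | inj₁ m' = j , ≤-refl , inChild d env a j m'
    ... | inj₂ m' with topsInSubtrees ds env a (suc j) m'
    ...   | j' , le , sub = j' , ≤-trans (n≤1+n j) le , sub

    topsInBranches : ∀ {Δ Γ Π} {s : I} {σ : ℕ → Fm}
                     (f : (i : Fin (k (S s))) → Der (open⟨ s , σ , i ⟩ ∷ Δ) (Γ ⇒ Π))
                     (env : Env Δ) (a : Address) → ∀ {p b} →
                     (p , b) ∈ topsF f env a → Σ (Fin (k (S s))) λ i → InSubtree a (toℕ i) p
    topsInBranches f env a m with branchOf f env a m
    ... | i , m' = i , inChild (f i) (ext env a) a (toℕ i) m'

    inChild : ∀ {Δ s} (d : Der Δ s) (env : Env Δ) (a : Address) (j : ℕ) → ∀ {p b} →
              (p , b) ∈ topsD d env (a ++ j ∷ []) → InSubtree a j p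
    inChild d env a j m with topsAbove d env (a ++ j ∷ []) m
    ... | xs , e = xs , trans e (++-assoc a (j ∷ []) xs)

  sameSubtree : ∀ a {p q j j'} → InSubtree a j p → InSubtree a j' q → Above p q → j ≡ j'
  sameSubtree a {j' = j'} (xs , refl) (ys , refl) (z , zs , e) =
    ∷-injectiveˡ (++-cancelˡ a _ _ (trans e (++-assoc a (j' ∷ ys) (z ∷ zs))))

  notAboveSelf : ∀ p → ¬ Above p p
  notAboveSelf p (x , xs , e) with ++-identityʳ-unique p e
  ... | ()

  onlyRoot : ∀ {p b a c} {L : List (Address × Address)} →
             (p , b) ∈ (a , c) ∷ L → (∀ {t} → t ∉ L) → p ≡ a
  onlyRoot (here refl) noL = refl
  onlyRoot (there m)   noL with noL m
  ... | ()

  mutual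
    flatNoneAbove : ∀ {Δ s} (d : Der Δ s) → Nest 1 d → (env : Env Δ) (a : Address) →
                    ∀ {p b q c} → (p , b) ∈ topsD d env a → (q , c) ∈ topsD d env a → ¬ Above p q
    flatNoneAbove (lj r ds) n env a mp mq = flatNoneAboves ds n env a 0 mp mq
    flatNoneAbove (top _ Γ Π ds) n env a mp mq
      with onlyRoot mp (topFreeNoTopss ds n env a 0) | onlyRoot mq (topFreeNoTopss ds n env a 0)
    ... | refl | refl = notAboveSelf a
    flatNoneAbove (bot s σ f) n env a mp mq above
      with branchOf f env a mp | branchOf f env a mq
    ... | i , mp' | i' , mq'
      with toℕ-injective (sameSubtree a (inChild (f i) (ext env a) a (toℕ i) mp')
                                        (inChild (f i') (ext env a) a (toℕ i') mq') above)
    ... | refl = flatNoneAbove (f i) (n i) (ext env a) (a ++ toℕ i ∷ []) mp' mq' above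

    flatNoneAboves : ∀ {Δ ss} (ds : Ders Δ ss) → Nests 1 ds → (env : Env Δ) (a : Address) (j : ℕ) →
                     ∀ {p b q c} → (p , b) ∈ topsDs ds env a j → (q , c) ∈ topsDs ds env a j →
                     ¬ Above p q
    flatNoneAboves (d ∷ ds) (n , ns) env a j mp mq above
      with ∈-++⁻ (topsD d env (a ++ j ∷ [])) mp | ∈-++⁻ (topsD d env (a ++ j ∷ [])) mq
    ... | inj₁ mp' | inj₁ mq' = flatNoneAbove d n env (a ++ j ∷ []) mp' mq' above
    ... | inj₂ mp' | inj₂ mq' = flatNoneAboves ds ns env a (suc j) mp' mq' above
    ... | inj₁ mp' | inj₂ mq' with topsInSubtrees ds env a (suc j) mq'
    ...   | j' , j<j' , sub with sameSubtree a (inChild d env a j mp') sub above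
    ...     | refl = <-irrefl refl j<j'
    flatNoneAboves (d ∷ ds) (n , ns) env a j mp mq above | inj₂ mp' | inj₁ mq'
      with topsInSubtrees ds env a (suc j) mp'
    ... | j' , j<j' , sub with sameSubtree a sub (inChild d env a j mq') above
    ...   | refl = <-irrefl refl j<j'

lemma2 : {I : Set} (S : I → TwoSystem) (s : Seq) (P : Calculus.Der S [] s) →
    Σ (Calculus.Der S [] s) (λ P' → ¬ Calculus.Entangled S P')
lemma2 S s P = P' , noEntanglement
  where
  open Flattening S

  P' : Calculus.Der S [] s
  P' = proj₁ (flatten P)

  -- entanglement needs a top rule above another, which a flat P' lacks
  noEntanglement : ¬ Calculus.Entangled S P'
  noEntanglement (_ , _ , _ , _ , _ , _ , _ , m₁ , m₂ , above , _) =
    flatNoneAbove P' (proj₂ (flatten P)) (λ ()) [] m₁ m₂ above
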